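{- Let $T$ be a tree (without loops), $v$ a vertex of $T$, $N_T(v)=\{w_1,\dots,w_s\}$ its set of neighbours, and $T_i$ the connected component of $T\setminus v$ containing $w_i$. Then $\nu_2(T)-\nu_2(T\setminus v)\in\{0,1,2\}$ and \[ \nu_2(T)-\nu_2(T\setminus v)=\begin{cases}2&\text{if and only if } v\text{ is saturated in }T,\\ 1&\text{if and only if there is } 1\le j\le s \text{ such that } vw_j \text{ is saturated (in } T) \text{ and } w_i \text{ is saturated in } T_i \text{ for all } i\ne j,\\ 0&\text{if and only if } w_i \text{ is saturated in } T_i \text{ for all } 1\le i\le s.\end{cases} \]
   Context: A tree is a finite simple connected graph without cycles; $T\setminus v$ is obtained by deleting the vertex $v$ and its incident edges. A $2$-matching of a graph is a set of edges such that every vertex is incident to at most two of them; $\nu_2(G)$ is the maximum size of a $2$-matching of $G$, and a $2$-matching of that size is maximum. A vertex is saturated in $G$ if every maximum $2$-matching of $G$ contains two edges incident to it; an edge is saturated in $G$ if it belongs to every maximum $2$-matching of $G$. -}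

module Defs where

open import Data.Nat using (ℕ; zero; suc; _+_; _≤_)
open import Data.Fin using (Fin; _≟_) renaming (_<_ to _<ᶠ_)
open import Data.Bool using (Bool; true; false; if_then_else_; _∨_)
open import Data.List using (List; []; _∷_; _++_; [_]; length)
open import Data.List.Relation.Unary.All using (All)
open import Data.List.Relation.Unary.Unique.Propositional using (Unique)
open import Data.Product using (Σ; ∃; _×_; _,_; proj₁; proj₂)
open import Data.Sum using (_⊎_)
open import Data.Unit using (⊤)
open import Relation.Nullary using (¬_; does)
open import Relation.Binary.PropositionalEquality using (_≡_; _≢_)
open import Level using (0ℓ)

record Graph (n : ℕ) : Set₁ where
  field
    Adj    : Fin n → Fin n → Set
    sym    : ∀ {u w} → Adj u w → Adj w u
    irrefl : ∀ {u} → ¬ Adj u u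
open Graph public

-- Vertex subsets (used for induced subgraphs G[S]).
VSet : ℕ → Set₁
VSet n = Fin n → Set

Full : ∀ {n} → VSet n
Full _ = ⊤

_∖_ : ∀ {n} → VSet n → Fin n → VSet n
(S ∖ v) u = S u × u ≢ v

data Walk {n} (G : Graph n) (S : VSet n) : Fin n → Fin n → Set where
  here : ∀ {u} → S u → Walk G S u u
  step : ∀ {u w x} → S u → Adj G u w → Walk G S w x → Walk G S u x

Connected : ∀ {n} → Graph n → Set
Connected G = ∀ u w → Walk G Full u w

ConsecAdj : ∀ {n} → Graph n → List (Fin n) → Set
ConsecAdj G []           = ⊤
ConsecAdj G (x ∷ [])     = ⊤
ConsecAdj G (x ∷ y ∷ xs) = Adj G x y × ConsecAdj G (y ∷ xs)

-- A cycle: distinct vertices x, x₁, …, x_k (k ≥ 2, so length ≥ 3),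
-- consecutive ones adjacent, and x_k adjacent to x.
HasCycle : ∀ {n} → Graph n → Set
HasCycle {n} G = Σ (Fin n) λ x → Σ (List (Fin n)) λ xs →
  (2 ≤ length xs) × Unique (x ∷ xs) × ConsecAdj G (x ∷ xs ++ [ x ])

IsTree : ∀ {n} → Graph n → Set
IsTree G = Connected G × ¬ HasCycle G

-- Edges are stored as ordered pairs (a , b) with a < b.
Edge : ℕ → Set
Edge n = Fin n × Fin n

deg : ∀ {n} → Fin n → List (Edge n) → ℕ
deg u [] = 0
deg u ((a , b) ∷ M) =
  (if does (a ≟ u) ∨ does (b ≟ u) then 1 else 0) + deg u M

IsEdgeIn : ∀ {n} → Graph n → VSet n → Edge n → Set
IsEdgeIn G S (a , b) = a <ᶠ b × S a × S b × Adj G a b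

Is2Matching : ∀ {n} → Graph n → VSet n → List (Edge n) → Set
Is2Matching G S M = All (IsEdgeIn G S) M × Unique M × (∀ u → deg u M ≤ 2)

IsNu2 : ∀ {n} → Graph n → VSet n → ℕ → Set
IsNu2 G S k = (Σ _ λ M → Is2Matching G S M × length M ≡ k)
            × (∀ M → Is2Matching G S M → length M ≤ k)

IsMax2Matching : ∀ {n} → Graph n → VSet n → List (Edge n) → Set
IsMax2Matching G S M =
  Is2Matching G S M × (∀ M′ → Is2Matching G S M′ → length M′ ≤ length M)

SatVertex : ∀ {n} → Graph n → VSet n → Fin n → Set
SatVertex G S v = ∀ M → IsMax2Matching G S M → deg v M ≡ 2

_∈ᴱ_ : ∀ {n} → Edge n → List (Edge n) → Set
(v , w) ∈ᴱ M = Data.List.Membership.Propositional._∈_ (v , w) M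
             ⊎ Data.List.Membership.Propositional._∈_ (w , v) M
  where import Data.List.Membership.Propositional

SatEdge : ∀ {n} → Graph n → VSet n → Fin n → Fin n → Set
SatEdge G S v w = ∀ M → IsMax2Matching G S M → (v , w) ∈ᴱ M

Component : ∀ {n} → Graph n → VSet n → Fin n → VSet n
Component G S w u = Walk G S w u

-- Deleting v splits T into branches, one for each neighbour w, and a 2-matching of T is a
-- 2-matching of each branch plus at most two spokes vw. Replacing the part of a matching inside
-- the branch of w by a maximum 2-matching of that branch, while dropping the spoke vw, loses no
-- edges, and the spoke can be kept when that maximum matching leaves w unsaturated.
-- So every 2-matching of T can be pushed, without shrinking, either to one avoiding v (size at
-- most ν₂(T ∖ v)) or to one using a spoke vw into a branch in which w is unsaturated; and each
-- such unsaturated w adds one spoke to a maximum matching of T ∖ v. Counting the spokes that can be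
-- added this way (none, one, or two) gives the three cases.
module Submission where

open import Defs
open import Data.Empty using (⊥-elim)
open import Data.Fin using (Fin; _≟_) renaming (_<_ to _<ᶠ_)
import Data.Fin.Properties as Finₚ
open import Data.List using (List; []; _∷_; _++_; [_]; length; filter)
open import Data.List.Properties using (length-++; filter-all; filter-none; filter-some)
open import Data.List.Membership.Propositional using (_∈_; _∉_; find)
open import Data.List.Membership.Propositional.Properties
  using (∈-filter⁺; ∈-filter⁻; ∈-++⁻)
open import Data.List.Relation.Unary.All as All using (All; []; _∷_)
import Data.List.Relation.Unary.All.Properties as Allₚ
open import Data.List.Relation.Unary.Any as Any using (here; there; any?)
open import Data.List.Relation.Unary.AllPairs using ([]; _∷_)
open import Data.List.Relation.Unary.Unique.Propositional using (Unique)
import Data.List.Relation.Unary.Unique.Propositional.Properties as Uniqueₚ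
open import Data.Nat using (ℕ; zero; suc; _+_; _≤_; _<_; z≤n; s≤s; _≤?_)
open import Data.Nat.Properties hiding (_≟_)
open import Data.Product using (Σ; ∃; _×_; _,_; proj₁; proj₂)
open import Data.Product.Properties using (≡-dec)
open import Data.Sum using (_⊎_; inj₁; inj₂; [_,_]′)
open import Data.Unit using (tt)
open import Function.Bundles using (_⇔_; mk⇔)
open import Relation.Nullary using (¬_; yes; no)
open import Relation.Nullary.Decidable using (_⊎-dec_; _×-dec_; ¬?)
open import Relation.Unary using (Pred) renaming (Decidable to Decidable₁)
open import Relation.Unary.Properties using (∁?)
open import Relation.Binary.Definitions using (DecidableEquality)
open import Relation.Binary.PropositionalEquality
  using (_≡_; _≢_; refl; trans; cong; subst; module ≡-Reasoning) renaming (sym to ≡-sym)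

module _ {a p} {A : Set a} {P : Pred A p} (P? : Decidable₁ P) where

  length-filter-partition : ∀ xs → length (filter P? xs) + length (filter (∁? P?) xs) ≡ length xs
  length-filter-partition []       = refl
  length-filter-partition (x ∷ xs) with P? x
  ... | yes _ = cong suc (length-filter-partition xs)
  ... | no  _ = trans (+-suc _ _) (cong suc (length-filter-partition xs))

module _ {a} {A : Set a} (_≟ₐ_ : DecidableEquality A) where

  length≤1+length-filter-≢ : ∀ {x} {xs : List A} → Unique xs →
    length xs ≤ suc (length (filter (λ y → ¬? (y ≟ₐ x)) xs))
  length≤1+length-filter-≢         {xs = []}     _            = z≤n
  length≤1+length-filter-≢ {x = x} {xs = y ∷ ys} (y∉ys ∷ uys) with y ≟ₐ x
  ... | no  _    = s≤s (length≤1+length-filter-≢ uys)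
  ... | yes refl = s≤s (≤-reflexive (cong length (≡-sym
                     (filter-all (λ z → ¬? (z ≟ₐ y)) (All.map (λ y≢z z≡y → y≢z (≡-sym z≡y)) y∉ys)))))

module _ {n : ℕ} where

  Touches : Fin n → Edge n → Set
  Touches u (a , b) = a ≡ u ⊎ b ≡ u

  touches? : (u : Fin n) → Decidable₁ (Touches u)
  touches? u (a , b) = a ≟ u ⊎-dec b ≟ u

  deg≡length-filter : ∀ u M → deg u M ≡ length (filter (touches? u) M)
  deg≡length-filter u []            = refl
  deg≡length-filter u ((a , b) ∷ M) with a ≟ u | b ≟ u
  ... | yes _ | _     = cong suc (deg≡length-filter u M)
  ... | no _  | yes _ = cong suc (deg≡length-filter u M)
  ... | no _  | no _  = deg≡length-filter u M

  deg-++ : ∀ (u : Fin n) M N → deg u (M ++ N) ≡ deg u M + deg u N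
  deg-++ u []            N = refl
  deg-++ u ((a , b) ∷ M) N with a ≟ u | b ≟ u
  ... | yes _ | _     = cong suc (deg-++ u M N)
  ... | no _  | yes _ = cong suc (deg-++ u M N)
  ... | no _  | no _  = deg-++ u M N

  deg-∷-touching : ∀ {u e} M → Touches u e → deg u (e ∷ M) ≡ suc (deg u M)
  deg-∷-touching {u} {a , b} M t with a ≟ u | b ≟ u
  ... | yes _   | _       = refl
  ... | no _    | yes _   = refl
  ... | no a≢u  | no b≢u  = ⊥-elim ([ a≢u , b≢u ]′ t)

  deg-∷-avoiding : ∀ {u e} M → ¬ Touches u e → deg u (e ∷ M) ≡ deg u M
  deg-∷-avoiding {u} {a , b} M ¬t with a ≟ u | b ≟ u
  ... | yes a≡u | _       = ⊥-elim (¬t (inj₁ a≡u))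
  ... | no _    | yes b≡u = ⊥-elim (¬t (inj₂ b≡u))
  ... | no _    | no _    = refl

  module _ {p} {P : Pred (Edge n) p} (P? : Decidable₁ P) where

    deg-filter-partition : ∀ u M → deg u (filter P? M) + deg u (filter (∁? P?) M) ≡ deg u M
    deg-filter-partition u []      = refl
    deg-filter-partition u (e ∷ M) with P? e | touches? u e
    ... | yes _ | yes t rewrite deg-∷-touching (filter P? M) t | deg-∷-touching M t =
      cong suc (deg-filter-partition u M)
    ... | yes _ | no ¬t rewrite deg-∷-avoiding (filter P? M) ¬t | deg-∷-avoiding M ¬t =
      deg-filter-partition u M
    ... | no _  | yes t rewrite deg-∷-touching (filter (∁? P?) M) t | deg-∷-touching M t =
      trans (+-suc _ _) (cong suc (deg-filter-partition u M))
    ... | no _  | no ¬t rewrite deg-∷-avoiding (filter (∁? P?) M) ¬t | deg-∷-avoiding M ¬t =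
      deg-filter-partition u M

    deg-filter-≤ : ∀ u M → deg u (filter P? M) ≤ deg u M
    deg-filter-≤ u M = subst (deg u (filter P? M) ≤_) (deg-filter-partition u M) (m≤m+n _ _)

  deg≡0 : ∀ {u M} → All (λ e → ¬ Touches u e) M → deg u M ≡ 0
  deg≡0 {u} {M} avoid = trans (deg≡length-filter u M) (cong length (filter-none (touches? u) avoid))

  ∈∧Touches⇒0<deg : ∀ {u e M} → e ∈ M → Touches u e → 0 < deg u M
  ∈∧Touches⇒0<deg {u} {e} {M} e∈M t = subst (0 <_) (≡-sym (deg≡length-filter u M))
    (filter-some (touches? u) (Any.map (λ { refl → t }) e∈M))

  deg≡0⇒∉ : ∀ {u e M} → deg u M ≡ 0 → Touches u e → e ∉ M
  deg≡0⇒∉ deg≡0 t e∈M = n≮0 (subst (0 <_) deg≡0 (∈∧Touches⇒0<deg e∈M t))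

  ∈ᴱ⇒0<deg : ∀ {u w M} → (u , w) ∈ᴱ M → 0 < deg u M
  ∈ᴱ⇒0<deg (inj₁ uw∈M) = ∈∧Touches⇒0<deg uw∈M (inj₁ refl)
  ∈ᴱ⇒0<deg (inj₂ wu∈M) = ∈∧Touches⇒0<deg wu∈M (inj₂ refl)

  edge : Fin n → Fin n → Edge n
  edge u w with u Finₚ.<? w
  ... | yes _ = u , w
  ... | no  _ = w , u

  edge-ordered : ∀ {u w} → u <ᶠ w → edge u w ≡ (u , w)
  edge-ordered {u} {w} u<w with u Finₚ.<? w
  ... | yes _   = refl
  ... | no  u≮w = ⊥-elim (u≮w u<w)

  edge-reversed : ∀ {u w} → ¬ u <ᶠ w → edge u w ≡ (w , u)
  edge-reversed {u} {w} u≮w with u Finₚ.<? w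
  ... | yes u<w = ⊥-elim (u≮w u<w)
  ... | no  _   = refl

  edge∈⇒∈ᴱ : ∀ {u w M} → edge u w ∈ M → (u , w) ∈ᴱ M
  edge∈⇒∈ᴱ {u} {w} e∈M with u Finₚ.<? w
  ... | yes _ = inj₁ e∈M
  ... | no  _ = inj₂ e∈M

  Touches-edgeˡ : ∀ u w → Touches u (edge u w)
  Touches-edgeˡ u w with u Finₚ.<? w
  ... | yes _ = inj₁ refl
  ... | no  _ = inj₂ refl

  Touches-edgeʳ : ∀ u w → Touches w (edge u w)
  Touches-edgeʳ u w with u Finₚ.<? w
  ... | yes _ = inj₂ refl
  ... | no  _ = inj₁ refl

  ¬Touches-edge : ∀ {x u w} → x ≢ u → x ≢ w → ¬ Touches x (edge u w)
  ¬Touches-edge {x} {u} {w} x≢u x≢w with u Finₚ.<? w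
  ... | yes _ = [ (λ u≡x → x≢u (≡-sym u≡x)) , (λ w≡x → x≢w (≡-sym w≡x)) ]′
  ... | no  _ = [ (λ w≡x → x≢w (≡-sym w≡x)) , (λ u≡x → x≢u (≡-sym u≡x)) ]′

  edge-injectiveʳ : ∀ {u a b} → edge u a ≡ edge u b → a ≡ b
  edge-injectiveʳ {u} {a} {b} eq with u Finₚ.<? a | u Finₚ.<? b
  ... | yes _ | yes _ = cong proj₂ eq
  ... | yes _ | no  _ = trans (cong proj₂ eq) (cong proj₁ eq)
  ... | no  _ | yes _ = trans (cong proj₁ eq) (cong proj₂ eq)
  ... | no  _ | no  _ = cong proj₁ eq

module _ {n} {G : Graph n} where

  Adj⇒≢ : ∀ {u w} → Adj G u w → w ≢ u
  Adj⇒≢ u~w refl = irrefl G u~w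

  edge-isEdgeIn : ∀ {u w} → Adj G u w → IsEdgeIn G Full (edge u w)
  edge-isEdgeIn {u} {w} u~w with u Finₚ.<? w
  ... | yes u<w = u<w , tt , tt , u~w
  ... | no  u≮w = Finₚ.≤∧≢⇒< (≮⇒≥ u≮w) (Adj⇒≢ u~w) , tt , tt , sym G u~w

  touching-edge : ∀ {S u e} → IsEdgeIn G S e → Touches u e → ∃ λ w → Adj G u w × e ≡ edge u w
  touching-edge (a<b , _ , _ , a~b) (inj₁ refl) = _ , a~b , ≡-sym (edge-ordered a<b)
  touching-edge (a<b , _ , _ , a~b) (inj₂ refl) =
    _ , sym G a~b , ≡-sym (edge-reversed (Finₚ.<-asym a<b))

  module _ {S : VSet n} where

    filter-is2Matching : ∀ {p} {P : Pred (Edge n) p} (P? : Decidable₁ P) {M} →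
      Is2Matching G S M → Is2Matching G S (filter P? M)
    filter-is2Matching P? {M} (edges , unique , degs) =
      Allₚ.filter⁺ P? edges , Uniqueₚ.filter⁺ P? unique , λ u → ≤-trans (deg-filter-≤ P? u M) (degs u)

    is2Matching-Full : ∀ {M} → Is2Matching G S M → Is2Matching G Full M
    is2Matching-Full (edges , unique , degs) =
      All.map (λ { (a<b , _ , _ , a~b) → a<b , tt , tt , a~b }) edges , unique , degs

    ν₂≤length : ∀ {k M} → IsNu2 G S k → IsMax2Matching G S M → k ≤ length M
    ν₂≤length ((M₀ , matching , refl) , _) (_ , maximal) = maximal M₀ matching

    ν₂≤length⇒isMax : ∀ {k M} → IsNu2 G S k → Is2Matching G S M → k ≤ length M →
      IsMax2Matching G S M
    ν₂≤length⇒isMax (_ , bound) matching k≤ = matching , λ M₀ m₀ → ≤-trans (bound M₀ m₀) k≤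

    SatVertex⇒¬deg≤1 : ∀ {u K} → SatVertex G S u → IsMax2Matching G S K → ¬ deg u K ≤ 1
    SatVertex⇒¬deg≤1 {u} {K} sat max deg≤1 with sat K max
    ... | deg≡2 = 1+n≰n (subst (_≤ 1) deg≡2 deg≤1)

    ¬deg≤1⇒SatVertex : ∀ {u} → (∀ K → IsMax2Matching G S K → ¬ deg u K ≤ 1) → SatVertex G S u
    ¬deg≤1⇒SatVertex {u} unsat K max@((_ , _ , degs) , _) with deg u K ≤? 1
    ... | yes deg≤1 = ⊥-elim (unsat K max deg≤1)
    ... | no  deg≰1 = ≤-antisym (degs u) (≰⇒> deg≰1)

  module _ {u : Fin n} where

    deg≡0⇒is2Matching-∖ : ∀ {M} → Is2Matching G Full M → deg u M ≡ 0 → Is2Matching G (Full ∖ u) M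
    deg≡0⇒is2Matching-∖ (edges , unique , degs) deg≡0 =
      All.tabulate (λ e∈M → avoid (All.lookup edges e∈M) (λ t → deg≡0⇒∉ deg≡0 t e∈M)) , unique , degs
      where
      avoid : ∀ {e} → IsEdgeIn G Full e → ¬ Touches u e → IsEdgeIn G (Full ∖ u) e
      avoid (a<b , _ , _ , a~b) ¬t = a<b , (tt , λ a≡u → ¬t (inj₁ a≡u)) , (tt , λ b≡u → ¬t (inj₂ b≡u)) , a~b

    is2Matching-∖⇒deg≡0 : ∀ {M} → Is2Matching G (Full ∖ u) M → deg u M ≡ 0
    is2Matching-∖⇒deg≡0 (edges , _) =
      deg≡0 (All.map (λ { (_ , (_ , a≢u) , (_ , b≢u) , _) → [ a≢u , b≢u ]′ }) edges)

    length≤ν₂-∖+deg : ∀ {k′ M} → IsNu2 G (Full ∖ u) k′ → Is2Matching G Full M → length M ≤ k′ + deg u M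
    length≤ν₂-∖+deg {k′} {M} (_ , bound) matching = begin
      length M                        ≡⟨ ≡-sym (length-filter-partition (touches? u) M) ⟩
      length (filter (touches? u) M) + length M₀ ≡⟨ +-comm _ (length M₀) ⟩
      length M₀ + length (filter (touches? u) M) ≡⟨ cong (length M₀ +_) (≡-sym (deg≡length-filter u M)) ⟩
      length M₀ + deg u M             ≤⟨ +-monoˡ-≤ (deg u M) (bound M₀ matching₀) ⟩
      k′ + deg u M                    ∎
      where
      open ≤-Reasoning
      M₀ = filter (∁? (touches? u)) M
      matching₀ : Is2Matching G (Full ∖ u) M₀
      matching₀ = deg≡0⇒is2Matching-∖ (filter-is2Matching (∁? (touches? u)) matching)
                    (deg≡0 (Allₚ.all-filter (∁? (touches? u)) M))

module _ {n} {G : Graph n} {S : VSet n} where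

  walk-target : ∀ {u x} → Walk G S u x → S x
  walk-target (here s)     = s
  walk-target (step _ _ w) = walk-target w

  walk-snoc : ∀ {u x y} → Walk G S u x → Adj G x y → S y → Walk G S u y
  walk-snoc (here s)       x~y sy = step s x~y (here sy)
  walk-snoc (step s u~w w) x~y sy = step s u~w (walk-snoc w x~y sy)

  walk-reverse : ∀ {u x} → Walk G S u x → Walk G S x u
  walk-reverse (here s)       = here s
  walk-reverse (step s u~w w) = walk-snoc (walk-reverse w) (sym G u~w) s

  walk-++ : ∀ {u x y} → Walk G S u x → Walk G S x y → Walk G S u y
  walk-++ (here _)       w′ = w′
  walk-++ (step s u~w w) w′ = step s u~w (walk-++ w w′)

walk-via-neighbour : ∀ {n} {G : Graph n} {u v} → Walk G Full u v → u ≢ v →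
  ∃ λ w → Adj G v w × Walk G (Full ∖ v) u w
walk-via-neighbour (here _) u≢v = ⊥-elim (u≢v refl)
walk-via-neighbour {G = G} {v = v} (step {u} {w} _ u~w rest) u≢v with w ≟ v
... | yes refl = u , sym G u~w , here (tt , u≢v)
... | no  w≢v  with walk-via-neighbour rest w≢v
...   | x , v~x , w⇝x = x , v~x , step (tt , u≢v) u~w w⇝x

module Branches {n} (T : Graph n) (tree : IsTree T) (v : Fin n) where

  V∖v : VSet n
  V∖v = Full ∖ v

  -- The neighbour of v whose component in T ∖ v contains u (junk value v at u = v).
  branch : Fin n → Fin n
  branch u with u ≟ v
  ... | yes _   = v
  ... | no  u≢v = proj₁ (walk-via-neighbour (proj₁ tree u v) u≢v)

  branch-spec : ∀ {u} → u ≢ v → Adj T v (branch u) × Walk T V∖v u (branch u)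
  branch-spec {u} u≢v with u ≟ v
  ... | yes u≡v = ⊥-elim (u≢v u≡v)
  ... | no  u≢v = proj₂ (walk-via-neighbour (proj₁ tree u v) u≢v)

  data SimplePath : Fin n → Fin n → List (Fin n) → Set where
    single : ∀ {u} → u ≢ v → SimplePath u u (u ∷ [])
    cons   : ∀ {u w x ps} → u ≢ v → Adj T u w → SimplePath w x ps → u ∉ ps → SimplePath u x (u ∷ ps)

  suffix : ∀ {w x ps u} → SimplePath w x ps → u ∈ ps → ∃ (SimplePath u x)
  suffix p@(single _)     (here refl)  = _ , p
  suffix p@(cons _ _ _ _) (here refl)  = _ , p
  suffix (cons _ _ p _)   (there u∈ps) = suffix p u∈ps

  walk⇒simplePath : ∀ {u x} → Walk T V∖v u x → ∃ (SimplePath u x)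
  walk⇒simplePath (here (_ , u≢v)) = _ , single u≢v
  walk⇒simplePath (step {u} (_ , u≢v) u~w rest) with walk⇒simplePath rest
  ... | ps , p with any? (u ≟_) ps
  ...   | yes u∈ps = suffix p u∈ps
  ...   | no  u∉ps = _ , cons u≢v u~w p u∉ps

  simplePath-unique : ∀ {u x ps} → SimplePath u x ps → Unique ps
  simplePath-unique (single _)             = [] ∷ []
  simplePath-unique (cons {ps = ps} _ _ p u∉ps) = Allₚ.¬Any⇒All¬ ps u∉ps ∷ simplePath-unique p

  simplePath-avoids : ∀ {u x ps} → SimplePath u x ps → All (v ≢_) ps
  simplePath-avoids (single u≢v)       = (λ v≡u → u≢v (≡-sym v≡u)) ∷ []
  simplePath-avoids (cons u≢v _ p _) = (λ v≡u → u≢v (≡-sym v≡u)) ∷ simplePath-avoids p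

  simplePath-consecAdj : ∀ {y u x z ps} → Adj T y u → SimplePath u x ps → Adj T x z →
    ConsecAdj T (y ∷ ps ++ [ z ])
  simplePath-consecAdj y~u (single _)       x~z = y~u , x~z , tt
  simplePath-consecAdj y~u (cons _ u~w p _) x~z = y~u , simplePath-consecAdj u~w p x~z

  simplePath-length : ∀ {u x ps} → SimplePath u x ps → u ≢ x → 2 ≤ length ps
  simplePath-length (single _)                  u≢u = ⊥-elim (u≢u refl)
  simplePath-length (cons _ _ (single _) _)     _   = s≤s (s≤s z≤n)
  simplePath-length (cons _ _ (cons _ _ _ _) _) _   = s≤s (s≤s z≤n)

  linked-neighbours-≡ : ∀ {a b} → Adj T v a → Adj T v b → Walk T V∖v a b → a ≡ b
  linked-neighbours-≡ {a} {b} v~a v~b a⇝b with a ≟ b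
  ... | yes a≡b = a≡b
  ... | no  a≢b with walk⇒simplePath a⇝b
  ...   | ps , p = ⊥-elim (proj₂ tree (v , ps , simplePath-length p a≢b ,
                     simplePath-avoids p ∷ simplePath-unique p ,
                     simplePath-consecAdj v~a p (sym T v~b)))

  branch-of-walk : ∀ {w u} → Adj T v w → Walk T V∖v w u → branch u ≡ w
  branch-of-walk v~w w⇝u with branch-spec (proj₂ (walk-target w⇝u))
  ... | v~r , u⇝r = ≡-sym (linked-neighbours-≡ v~w v~r (walk-++ w⇝u u⇝r))

  branch-of-neighbour : ∀ {w} → Adj T v w → branch w ≡ w
  branch-of-neighbour v~w = branch-of-walk v~w (here (tt , Adj⇒≢ {G = T} v~w))

  branch-adjacent : ∀ {a b} → Adj T a b → a ≢ v → b ≢ v → branch a ≡ branch b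
  branch-adjacent a~b a≢v b≢v with branch-spec b≢v
  ... | v~r , b⇝r = branch-of-walk v~r (walk-reverse (step (tt , a≢v) a~b b⇝r))

  walk-from-branch : ∀ {u} → u ≢ v → Walk T V∖v (branch u) u
  walk-from-branch u≢v = walk-reverse (proj₂ (branch-spec u≢v))

  Branch : Fin n → VSet n
  Branch w = Component T V∖v w

  spoke : Fin n → Edge n
  spoke w = edge v w

  _⊆ᵛ_ : List (Edge n) → List (Edge n) → Set
  M₁ ⊆ᵛ M₂ = ∀ {e} → e ∈ M₁ → Touches v e → e ∈ M₂

  UnsaturatedBranch : Fin n → Set
  UnsaturatedBranch w = ∃ λ K → IsMax2Matching T (Branch w) K × deg w K ≤ 1

  InBranch : Fin n → Edge n → Set
  InBranch w (a , b) = a ≢ v × b ≢ v × branch a ≡ w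

  inBranch? : ∀ w → Decidable₁ (InBranch w)
  inBranch? w (a , b) = ¬? (a ≟ v) ×-dec ¬? (b ≟ v) ×-dec branch a ≟ w

  _≟ᴱ_ : DecidableEquality (Edge n)
  _≟ᴱ_ = ≡-dec _≟_ _≟_

  inside : Fin n → List (Edge n) → List (Edge n)
  inside w = filter (inBranch? w)

  outside : Fin n → List (Edge n) → List (Edge n)
  outside w = filter (∁? (inBranch? w))

  others : Fin n → List (Edge n) → List (Edge n)
  others w M = filter (λ e → ¬? (e ≟ᴱ spoke w)) (outside w M)

  graft : Fin n → List (Edge n) → List (Edge n) → List (Edge n)
  graft w M N = others w M ++ N

  Touches-spoke⇒≡ : ∀ {u} w → Touches u (spoke w) → u ≢ v → u ≡ w
  Touches-spoke⇒≡ {u} w t u≢v with u ≟ w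
  ... | yes u≡w = u≡w
  ... | no  u≢w = ⊥-elim (¬Touches-edge u≢v u≢w t)

  ¬InBranch-spoke : ∀ {w′} w → ¬ InBranch w′ (spoke w)
  ¬InBranch-spoke w (a≢v , b≢v , _) = [ a≢v , b≢v ]′ (Touches-edgeˡ v w)

  ∈-others⁻ : ∀ {w M e} → e ∈ others w M → e ∈ M × ¬ InBranch w e × e ≢ spoke w
  ∈-others⁻ {w} e∈ with ∈-filter⁻ (λ e → ¬? (e ≟ᴱ spoke w)) e∈
  ... | e∈outside , e≢spoke with ∈-filter⁻ (∁? (inBranch? w)) e∈outside
  ...   | e∈M , ¬inside = e∈M , ¬inside , e≢spoke

  deg-others-≤ : ∀ u w M → deg u (others w M) ≤ deg u M
  deg-others-≤ u w M = ≤-trans (deg-filter-≤ (λ e → ¬? (e ≟ᴱ spoke w)) u (outside w M))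
                               (deg-filter-≤ (∁? (inBranch? w)) u M)

  deg-v-others-< : ∀ {w M} → spoke w ∈ M → deg v (others w M) < deg v M
  deg-v-others-< {w} {M} spoke∈M = begin-strict
    deg v (others w M)
      <⟨ m<n+m _ (∈∧Touches⇒0<deg spoke∈ (Touches-edgeˡ v w)) ⟩
    deg v (filter (_≟ᴱ spoke w) (outside w M)) + deg v (others w M)
      ≡⟨ deg-filter-partition (_≟ᴱ spoke w) v (outside w M) ⟩
    deg v (outside w M)                                      ≤⟨ deg-filter-≤ (∁? (inBranch? w)) v M ⟩
    deg v M                                                  ∎
    where
    open ≤-Reasoning
    spoke∈ : spoke w ∈ filter (_≟ᴱ spoke w) (outside w M)
    spoke∈ = ∈-filter⁺ (_≟ᴱ spoke w) (∈-filter⁺ (∁? (inBranch? w)) spoke∈M (¬InBranch-spoke w)) refl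

  length≤inside+1+others : ∀ {w M} → Unique M → length M ≤ length (inside w M) + suc (length (others w M))
  length≤inside+1+others {w} {M} unique = begin
    length M                                      ≡⟨ ≡-sym (length-filter-partition (inBranch? w) M) ⟩
    length (inside w M) + length (outside w M)    ≤⟨ +-monoʳ-≤ (length (inside w M))
                                                       (length≤1+length-filter-≢ _≟ᴱ_
                                                         (Uniqueₚ.filter⁺ (∁? (inBranch? w)) unique)) ⟩
    length (inside w M) + suc (length (others w M)) ∎
    where open ≤-Reasoning

  length≡inside+others : ∀ {w M} → spoke w ∉ M → length M ≡ length (inside w M) + length (others w M)
  length≡inside+others {w} {M} spoke∉M = begin
    length M                                   ≡⟨ ≡-sym (length-filter-partition (inBranch? w) M) ⟩
    length (inside w M) + length (outside w M) ≡⟨ cong (λ L → length (inside w M) + length L) (≡-sym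
                                                    (filter-all (λ e → ¬? (e ≟ᴱ spoke w)) (All.tabulate ≢spoke))) ⟩
    length (inside w M) + length (others w M)  ∎
    where
    open ≡-Reasoning
    ≢spoke : ∀ {e} → e ∈ outside w M → e ≢ spoke w
    ≢spoke e∈ refl = spoke∉M (proj₁ (∈-filter⁻ (∁? (inBranch? w)) e∈))

  inside-is2Matching : ∀ {w M} → Is2Matching T Full M → Is2Matching T (Branch w) (inside w M)
  inside-is2Matching {w} {M} matching with filter-is2Matching {G = T} (inBranch? w) matching
  ... | edges , unique , degs = All.zipWith toBranch (edges , Allₚ.all-filter (inBranch? w) M) , unique , degs
    where
    toBranch : ∀ {e} → IsEdgeIn T Full e × InBranch w e → IsEdgeIn T (Branch w) e
    toBranch ((a<b , _ , _ , a~b) , a≢v , b≢v , branch≡w) =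
      a<b , w⇝a , walk-snoc w⇝a a~b (tt , b≢v) , a~b
      where w⇝a = subst (λ r → Walk T V∖v r _) branch≡w (walk-from-branch a≢v)

  deg-inside≤1 : ∀ {w M} → Is2Matching T Full M → spoke w ∈ M → deg w (inside w M) ≤ 1
  deg-inside≤1 {w} {M} (_ , _ , degs) spoke∈M = ≤-pred (begin
    suc (deg w (inside w M))                   ≡⟨ +-comm 1 _ ⟩
    deg w (inside w M) + 1                     ≤⟨ +-monoʳ-≤ (deg w (inside w M))
                                                    (∈∧Touches⇒0<deg spoke∈outside (Touches-edgeʳ v w)) ⟩
    deg w (inside w M) + deg w (outside w M)   ≡⟨ deg-filter-partition (inBranch? w) w M ⟩
    deg w M                                    ≤⟨ degs w ⟩
    2                                          ∎)
    where
    open ≤-Reasoning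
    spoke∈outside : spoke w ∈ outside w M
    spoke∈outside = ∈-filter⁺ (∁? (inBranch? w)) spoke∈M (¬InBranch-spoke w)

  module _ {w} (v~w : Adj T v w) where

    branch-edge-inBranch : ∀ {e} → IsEdgeIn T (Branch w) e → InBranch w e
    branch-edge-inBranch (_ , w⇝a , w⇝b , _) =
      proj₂ (walk-target w⇝a) , proj₂ (walk-target w⇝b) , branch-of-walk v~w w⇝a

    branch-edge-¬Touches-v : ∀ {e} → IsEdgeIn T (Branch w) e → ¬ Touches v e
    branch-edge-¬Touches-v e∈branch with branch-edge-inBranch e∈branch
    ... | a≢v , b≢v , _ = [ a≢v , b≢v ]′

    deg-v-branch : ∀ {N} → Is2Matching T (Branch w) N → deg v N ≡ 0
    deg-v-branch (edges , _) = deg≡0 (All.map branch-edge-¬Touches-v edges)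

    deg-off-branch : ∀ {u N} → Is2Matching T (Branch w) N → branch u ≢ w → deg u N ≡ 0
    deg-off-branch {u} (edges , _) branch≢w = deg≡0 (All.map avoid edges)
      where
      avoid : ∀ {e} → IsEdgeIn T (Branch w) e → ¬ Touches u e
      avoid (_ , w⇝a , _   , _) (inj₁ refl) = branch≢w (branch-of-walk v~w w⇝a)
      avoid (_ , _   , w⇝b , _) (inj₂ refl) = branch≢w (branch-of-walk v~w w⇝b)

    others-avoid-branch : ∀ {M u} → Is2Matching T Full M → u ≢ v → branch u ≡ w → deg u (others w M) ≡ 0
    others-avoid-branch {M} {u} (edges , _) u≢v branch-u≡w = deg≡0 (All.tabulate avoid)
      where
      avoid : ∀ {e} → e ∈ others w M → ¬ Touches u e
      avoid {e} e∈ t with ∈-others⁻ e∈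
      ... | e∈M , ¬inside , e≢spoke with touches? v e
      ...   | yes t-v with touching-edge {G = T} {S = Full} (All.lookup edges e∈M) t-v
      ...     | w′ , v~w′ , refl = e≢spoke (cong spoke (begin
                  w′        ≡⟨ ≡-sym (branch-of-neighbour v~w′) ⟩
                  branch w′ ≡⟨ cong branch (≡-sym (Touches-spoke⇒≡ w′ t u≢v)) ⟩
                  branch u  ≡⟨ branch-u≡w ⟩
                  w         ∎))
                where open ≡-Reasoning
      avoid {a , b} e∈ t | e∈M , ¬inside , _ | no ¬t-v =
        ¬inside (a≢v , b≢v , branch-a≡w t)
        where
        a≢v = λ a≡v → ¬t-v (inj₁ a≡v)
        b≢v = λ b≡v → ¬t-v (inj₂ b≡v)
        branch-a≡w : Touches u (a , b) → branch a ≡ w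
        branch-a≡w (inj₁ refl) = branch-u≡w
        branch-a≡w (inj₂ refl) =
          trans (branch-adjacent (proj₂ (proj₂ (proj₂ (All.lookup edges e∈M)))) a≢v b≢v) branch-u≡w

    deg-graft-v : ∀ {M N} → Is2Matching T (Branch w) N → deg v (graft w M N) ≡ deg v (others w M)
    deg-graft-v {M} {N} matchingN = begin
      deg v (others w M ++ N)        ≡⟨ deg-++ v (others w M) N ⟩
      deg v (others w M) + deg v N   ≡⟨ cong (deg v (others w M) +_) (deg-v-branch matchingN) ⟩
      deg v (others w M) + 0         ≡⟨ +-identityʳ _ ⟩
      deg v (others w M)             ∎
      where open ≡-Reasoning

    deg-graft-on-branch : ∀ {M N u} → Is2Matching T Full M → u ≢ v → branch u ≡ w →
      deg u (graft w M N) ≡ deg u N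
    deg-graft-on-branch {M} {N} {u} matchingM u≢v branch≡w =
      trans (deg-++ u (others w M) N) (cong (_+ deg u N) (others-avoid-branch matchingM u≢v branch≡w))

    deg-graft-off-branch : ∀ {M N u} → Is2Matching T (Branch w) N → branch u ≢ w →
      deg u (graft w M N) ≡ deg u (others w M)
    deg-graft-off-branch {M} {N} {u} matchingN branch≢w = begin
      deg u (others w M ++ N)        ≡⟨ deg-++ u (others w M) N ⟩
      deg u (others w M) + deg u N   ≡⟨ cong (deg u (others w M) +_) (deg-off-branch matchingN branch≢w) ⟩
      deg u (others w M) + 0         ≡⟨ +-identityʳ _ ⟩
      deg u (others w M)             ∎
      where open ≡-Reasoning

    graft-is2Matching : ∀ {M N} → Is2Matching T Full M → Is2Matching T (Branch w) N →
      Is2Matching T Full (graft w M N)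
    graft-is2Matching {M} {N} matchingM@(_ , _ , degsM) matchingN@(edgesN , uniqueN , degsN)
      with filter-is2Matching {G = T} (λ e → ¬? (e ≟ᴱ spoke w))
             (filter-is2Matching {G = T} (∁? (inBranch? w)) matchingM)
    ... | edgesO , uniqueO , _ =
      Allₚ.++⁺ edgesO (proj₁ (is2Matching-Full {G = T} matchingN)) , Uniqueₚ.++⁺ uniqueO uniqueN disjoint , degs
      where
      disjoint : ∀ {e} → ¬ (e ∈ others w M × e ∈ N)
      disjoint (e∈O , e∈N) = proj₁ (proj₂ (∈-others⁻ {w} {M} e∈O)) (branch-edge-inBranch (All.lookup edgesN e∈N))
      degs : ∀ u → deg u (graft w M N) ≤ 2
      degs u with u ≟ v
      ... | yes refl = ≤-trans (≤-reflexive (deg-graft-v {M} matchingN)) (≤-trans (deg-others-≤ v w M) (degsM v))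
      ... | no u≢v with branch u ≟ w
      ...   | yes branch≡w = ≤-trans (≤-reflexive (deg-graft-on-branch {N = N} matchingM u≢v branch≡w)) (degsN u)
      ...   | no  branch≢w = ≤-trans (≤-reflexive (deg-graft-off-branch {M} matchingN branch≢w))
                                     (≤-trans (deg-others-≤ u w M) (degsM u))

    spoke∷graft-is2Matching : ∀ {M N} → Is2Matching T Full M → Is2Matching T (Branch w) N →
      deg v (others w M) ≤ 1 → deg w N ≤ 1 → Is2Matching T Full (spoke w ∷ graft w M N)
    spoke∷graft-is2Matching {M} {N} matchingM matchingN deg-v≤1 deg-w≤1
      with graft-is2Matching matchingM matchingN
    ... | edges , unique , degs = edge-isEdgeIn {G = T} v~w ∷ edges , All.tabulate spoke≢ ∷ unique , degs′
      where
      spoke≢ : ∀ {e} → e ∈ graft w M N → spoke w ≢ e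
      spoke≢ e∈ refl with ∈-++⁻ (others w M) e∈
      ... | inj₁ e∈O = proj₂ (proj₂ (∈-others⁻ {w} {M} e∈O)) refl
      ... | inj₂ e∈N = branch-edge-¬Touches-v (All.lookup (proj₁ matchingN) e∈N) (Touches-edgeˡ v w)
      degs′ : ∀ u → deg u (spoke w ∷ graft w M N) ≤ 2
      degs′ u with u ≟ v | u ≟ w
      ... | yes refl | _ = begin
        deg v (spoke w ∷ graft w M N)  ≡⟨ deg-∷-touching (graft w M N) (Touches-edgeˡ v w) ⟩
        suc (deg v (graft w M N))      ≡⟨ cong suc (deg-graft-v {M} matchingN) ⟩
        suc (deg v (others w M))       ≤⟨ s≤s deg-v≤1 ⟩
        2                              ∎
        where open ≤-Reasoning
      ... | no u≢v | yes refl = begin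
        deg w (spoke w ∷ graft w M N)  ≡⟨ deg-∷-touching (graft w M N) (Touches-edgeʳ v w) ⟩
        suc (deg w (graft w M N))
          ≡⟨ cong suc (deg-graft-on-branch {N = N} matchingM u≢v (branch-of-neighbour v~w)) ⟩
        suc (deg w N)                  ≤⟨ s≤s deg-w≤1 ⟩
        2                              ∎
        where open ≤-Reasoning
      ... | no u≢v | no u≢w =
        ≤-trans (≤-reflexive (deg-∷-avoiding (graft w M N) (¬Touches-edge u≢v u≢w))) (degs u)

    graft-⊆ᵛ : ∀ {M N} → Is2Matching T (Branch w) N → graft w M N ⊆ᵛ M
    graft-⊆ᵛ {M} matchingN e∈ t with ∈-++⁻ (others w M) e∈
    ... | inj₁ e∈O = proj₁ (∈-others⁻ {w} {M} e∈O)
    ... | inj₂ e∈N = ⊥-elim (branch-edge-¬Touches-v (All.lookup (proj₁ matchingN) e∈N) t)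

    improve-at : ∀ {M N} → Is2Matching T Full M → spoke w ∈ M → Is2Matching T (Branch w) N →
      length (inside w M) < length N →
      Is2Matching T Full (graft w M N) × length M ≤ length (graft w M N)
      × deg v (graft w M N) < deg v M × graft w M N ⊆ᵛ M
    improve-at {M} {N} matchingM spoke∈M matchingN inside<N =
      graft-is2Matching matchingM matchingN , longer ,
      ≤-trans (≤-reflexive (cong suc (deg-graft-v {M} matchingN))) (deg-v-others-< spoke∈M) ,
      graft-⊆ᵛ matchingN
      where
      open ≤-Reasoning
      longer : length M ≤ length (graft w M N)
      longer = begin
        length M                                         ≤⟨ length≤inside+1+others (proj₁ (proj₂ matchingM)) ⟩
        length (inside w M) + suc (length (others w M))  ≡⟨ +-suc _ _ ⟩
        suc (length (inside w M)) + length (others w M)  ≤⟨ +-monoˡ-≤ _ inside<N ⟩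
        length N + length (others w M)                   ≡⟨ +-comm (length N) _ ⟩
        length (others w M) + length N                   ≡⟨ ≡-sym (length-++ (others w M)) ⟩
        length (graft w M N)                             ∎

    extend-at : ∀ {M N} → Is2Matching T Full M → spoke w ∉ M → deg v M ≤ 1 →
      Is2Matching T (Branch w) N → deg w N ≤ 1 → length (inside w M) ≤ length N →
      Is2Matching T Full (spoke w ∷ graft w M N) × length M < length (spoke w ∷ graft w M N)
      × deg v (spoke w ∷ graft w M N) ≤ suc (deg v M) × (spoke w ∷ graft w M N) ⊆ᵛ (spoke w ∷ M)
    extend-at {M} {N} matchingM spoke∉M deg-v≤1 matchingN deg-w≤1 inside≤N =
      spoke∷graft-is2Matching matchingM matchingN (≤-trans (deg-others-≤ v w M) deg-v≤1) deg-w≤1 ,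
      s≤s longer , fewer , spokes
      where
      open ≤-Reasoning
      longer : length M ≤ length (graft w M N)
      longer = begin
        length M                                   ≡⟨ length≡inside+others spoke∉M ⟩
        length (inside w M) + length (others w M)  ≤⟨ +-monoˡ-≤ _ inside≤N ⟩
        length N + length (others w M)             ≡⟨ +-comm (length N) _ ⟩
        length (others w M) + length N             ≡⟨ ≡-sym (length-++ (others w M)) ⟩
        length (graft w M N)                       ∎
      fewer : deg v (spoke w ∷ graft w M N) ≤ suc (deg v M)
      fewer = begin
        deg v (spoke w ∷ graft w M N)  ≡⟨ deg-∷-touching (graft w M N) (Touches-edgeˡ v w) ⟩
        suc (deg v (graft w M N))      ≡⟨ cong suc (deg-graft-v {M} matchingN) ⟩
        suc (deg v (others w M))       ≤⟨ s≤s (deg-others-≤ v w M) ⟩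
        suc (deg v M)                  ∎
      spokes : (spoke w ∷ graft w M N) ⊆ᵛ (spoke w ∷ M)
      spokes (here refl) _ = here refl
      spokes (there e∈)  t = there (graft-⊆ᵛ matchingN e∈ t)

  module Maximum {k′} (ν′ : IsNu2 T V∖v k′) where

    M′ : List (Edge n)
    M′ = proj₁ (proj₁ ν′)

    matchingM′ : Is2Matching T V∖v M′
    matchingM′ = proj₁ (proj₂ (proj₁ ν′))

    length-M′ : length M′ ≡ k′
    length-M′ = proj₂ (proj₂ (proj₁ ν′))

    deg-v-M′ : deg v M′ ≡ 0
    deg-v-M′ = is2Matching-∖⇒deg≡0 {G = T} matchingM′

    spoke∉M′ : ∀ w → spoke w ∉ M′
    spoke∉M′ w = deg≡0⇒∉ deg-v-M′ (Touches-edgeˡ v w)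

    -- replacing the inside of M′ by a larger matching of the branch would beat ν₂(T ∖ v)
    inside-M′-isMax : ∀ {w} → Adj T v w → IsMax2Matching T (Branch w) (inside w M′)
    inside-M′-isMax {w} v~w = inside-is2Matching (is2Matching-Full {G = T} matchingM′) , maximal
      where
      maximal : ∀ N → Is2Matching T (Branch w) N → length N ≤ length (inside w M′)
      maximal N matchingN = +-cancelʳ-≤ (length (others w M′)) _ _ (begin
        length N + length (others w M′)                ≡⟨ +-comm (length N) _ ⟩
        length (others w M′) + length N                ≡⟨ ≡-sym (length-++ (others w M′)) ⟩
        length (graft w M′ N)                          ≤⟨ proj₂ ν′ _ graft-avoids-v ⟩
        k′                                             ≡⟨ ≡-sym length-M′ ⟩
        length M′                                      ≡⟨ length≡inside+others (spoke∉M′ w) ⟩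
        length (inside w M′) + length (others w M′)    ∎)
        where
        open ≤-Reasoning
        graft-avoids-v : Is2Matching T V∖v (graft w M′ N)
        graft-avoids-v = deg≡0⇒is2Matching-∖ {G = T}
          (graft-is2Matching v~w (is2Matching-Full {G = T} matchingM′) matchingN)
          (trans (deg-graft-v v~w {M′} matchingN)
                 (n≤0⇒n≡0 (subst (deg v (others w M′) ≤_) deg-v-M′ (deg-others-≤ v w M′))))

    -- Each grafting step drops a spoke without losing edges; the fuel bounds the number of spokes.
    spoke-free-or-unsaturated : ∀ fuel {M} → Is2Matching T Full M → deg v M ≤ fuel →
      (∃ λ M₀ → Is2Matching T V∖v M₀ × length M ≤ length M₀)
      ⊎ (∃ λ w → Adj T v w × spoke w ∈ M × UnsaturatedBranch w)
    spoke-free-or-unsaturated fuel {M} matching deg≤fuel with any? (touches? v) M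
    ... | no ¬spoke =
      inj₁ (M , deg≡0⇒is2Matching-∖ {G = T} matching (deg≡0 (Allₚ.¬Any⇒All¬ M ¬spoke)) , ≤-refl)
    ... | yes spoke with find spoke
    ...   | e , e∈M , touches with touching-edge {G = T} {S = Full} (All.lookup (proj₁ matching) e∈M) touches
    ...     | w , v~w , refl with length (inside w M′) ≤? length (inside w M)
    ...       | yes maxed = inj₂ (w , v~w , e∈M , inside w M ,
                  (inside-is2Matching matching ,
                   λ N matchingN → ≤-trans (proj₂ (inside-M′-isMax v~w) N matchingN) maxed) ,
                  deg-inside≤1 matching e∈M)
    ...       | no ¬maxed with improve-at v~w matching e∈M (proj₁ (inside-M′-isMax v~w)) (≰⇒> ¬maxed) | fuel
    ...         | _ , _ , fewer , _ | zero = ⊥-elim (n≮0 (≤-trans fewer deg≤fuel))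
    ...         | matching₁ , longer , fewer , spokes | suc fuel′
                  with spoke-free-or-unsaturated fuel′ matching₁ (≤-pred (≤-trans fewer deg≤fuel))
    ...           | inj₁ (M₀ , matching₀ , longer₀) = inj₁ (M₀ , matching₀ , ≤-trans longer longer₀)
    ...           | inj₂ (w′ , v~w′ , spoke∈ , unsat) =
                    inj₂ (w′ , v~w′ , spokes spoke∈ (Touches-edgeˡ v w′) , unsat)

    length≤ν₂∖v : ∀ {M} → Is2Matching T Full M →
      (∀ {w} → Adj T v w → spoke w ∈ M → SatVertex T (Branch w) w) → length M ≤ k′
    length≤ν₂∖v matching saturated with spoke-free-or-unsaturated 2 matching (proj₂ (proj₂ matching) v)
    ... | inj₁ (M₀ , matching₀ , longer) = ≤-trans longer (proj₂ ν′ M₀ matching₀)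
    ... | inj₂ (w , v~w , spoke∈ , K , maxK , deg≤1) =
      ⊥-elim (SatVertex⇒¬deg≤1 {G = T} (saturated v~w spoke∈) maxK deg≤1)

    extend-M′ : ∀ {w} → Adj T v w → UnsaturatedBranch w →
      ∃ λ M₁ → Is2Matching T Full M₁ × k′ < length M₁ × deg v M₁ ≤ 1 × M₁ ⊆ᵛ (spoke w ∷ M′)
    extend-M′ {w} v~w (K , (matchingK , maximalK) , deg-w≤1)
      with extend-at v~w (is2Matching-Full {G = T} matchingM′) (spoke∉M′ w) (≤-trans (≤-reflexive deg-v-M′) z≤n)
             matchingK deg-w≤1 (maximalK _ (inside-is2Matching (is2Matching-Full {G = T} matchingM′)))
    ... | matching₁ , longer , fewer , spokes =
      _ , matching₁ , subst (_< _) length-M′ longer ,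
      subst (λ d → deg v (spoke w ∷ graft w M′ K) ≤ suc d) deg-v-M′ fewer , spokes

    extend-M′-twice : ∀ {wi wj} → Adj T v wi → Adj T v wj → wi ≢ wj →
      UnsaturatedBranch wi → UnsaturatedBranch wj → ∃ λ M₂ → Is2Matching T Full M₂ × suc k′ < length M₂
    extend-M′-twice {wi} {wj} v~wi v~wj wi≢wj (N , (matchingN , maximalN) , deg≤1) unsat
      with extend-M′ v~wj unsat
    ... | M₁ , matching₁ , longer₁ , deg-v≤1 , spokes₁
      with extend-at v~wi matching₁ spoke∉M₁ deg-v≤1 matchingN deg≤1 (maximalN _ (inside-is2Matching matching₁))
      where
      spoke∉M₁ : spoke wi ∉ M₁
      spoke∉M₁ spoke∈ with spokes₁ spoke∈ (Touches-edgeˡ v wi)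
      ... | here  eq      = wi≢wj (edge-injectiveʳ eq)
      ... | there spoke∈′ = spoke∉M′ wi spoke∈′
    ...   | matching₂ , longer₂ , _ = _ , matching₂ , ≤-trans (s≤s longer₁) longer₂

n≡m⊎1+m⊎2+m : ∀ {m n} → m ≤ n → n ≤ 2 + m → n ≡ m ⊎ n ≡ suc m ⊎ n ≡ 2 + m
n≡m⊎1+m⊎2+m {m} m≤n n≤2+m with m≤n⇒∃[o]m+o≡n m≤n
... | d , refl with +-cancelˡ-≤ m d 2 (subst (m + d ≤_) (+-comm 2 m) n≤2+m)
...   | z≤n           = inj₁ (+-identityʳ m)
...   | s≤s z≤n       = inj₂ (inj₁ (+-comm m 1))
...   | s≤s (s≤s z≤n) = inj₂ (inj₂ (+-comm m 2))

module Drop {n} (T : Graph n) (tree : IsTree T) (v : Fin n) {k k′}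
            (ν : IsNu2 T Full k) (ν′ : IsNu2 T (Full ∖ v) k′) where

  open Branches T tree v
  open Maximum ν′

  Mₛ : List (Edge n)
  Mₛ = proj₁ (proj₁ ν)

  matchingMₛ : Is2Matching T Full Mₛ
  matchingMₛ = proj₁ (proj₂ (proj₁ ν))

  length-Mₛ : length Mₛ ≡ k
  length-Mₛ = proj₂ (proj₂ (proj₁ ν))

  length≤ν₂ : ∀ {M} → Is2Matching T Full M → length M ≤ k
  length≤ν₂ = proj₂ ν _

  isMax : ∀ {M} → Is2Matching T Full M → k ≤ length M → IsMax2Matching T Full M
  isMax = ν₂≤length⇒isMax {G = T} ν

  k′≤k : k′ ≤ k
  k′≤k = subst (_≤ k) length-M′ (length≤ν₂ (is2Matching-Full {G = T} matchingM′))

  k≤2+k′ : k ≤ 2 + k′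
  k≤2+k′ = begin
    k               ≡⟨ ≡-sym length-Mₛ ⟩
    length Mₛ       ≤⟨ length≤ν₂-∖+deg {G = T} ν′ matchingMₛ ⟩
    k′ + deg v Mₛ   ≤⟨ +-monoʳ-≤ k′ (proj₂ (proj₂ matchingMₛ) v) ⟩
    k′ + 2          ≡⟨ +-comm k′ 2 ⟩
    2 + k′          ∎
    where open ≤-Reasoning

  drop∈0,1,2 : k ≡ k′ ⊎ k ≡ suc k′ ⊎ k ≡ 2 + k′
  drop∈0,1,2 = n≡m⊎1+m⊎2+m k′≤k k≤2+k′

  drop>0⇒unsaturated : k′ < k → ∃ λ w → Adj T v w × UnsaturatedBranch w
  drop>0⇒unsaturated k′<k with spoke-free-or-unsaturated 2 matchingMₛ (proj₂ (proj₂ matchingMₛ) v)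
  ... | inj₁ (M₀ , matching₀ , longer) =
    ⊥-elim (<⇒≱ k′<k (≤-trans (≤-reflexive (≡-sym length-Mₛ)) (≤-trans longer (proj₂ ν′ M₀ matching₀))))
  ... | inj₂ (w , v~w , _ , unsat) = w , v~w , unsat

  drop≡2⇒saturated : k ≡ 2 + k′ → SatVertex T Full v
  drop≡2⇒saturated k≡2+k′ M maxM@(matching , _) =
    ≤-antisym (proj₂ (proj₂ matching) v) (+-cancelˡ-≤ k′ 2 _ (begin
      k′ + 2         ≡⟨ +-comm k′ 2 ⟩
      2 + k′         ≡⟨ ≡-sym k≡2+k′ ⟩
      k              ≤⟨ ν₂≤length {G = T} ν maxM ⟩
      length M       ≤⟨ length≤ν₂-∖+deg {G = T} ν′ matching ⟩
      k′ + deg v M   ∎))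
    where open ≤-Reasoning

  saturated⇒drop≡2 : SatVertex T Full v → k ≡ 2 + k′
  saturated⇒drop≡2 saturated with drop∈0,1,2
  ... | inj₂ (inj₂ k≡2+k′) = k≡2+k′
  ... | inj₁ k≡k′ = ⊥-elim (SatVertex⇒¬deg≤1 {G = T} saturated
          (isMax (is2Matching-Full {G = T} matchingM′) (≤-reflexive (trans k≡k′ (≡-sym length-M′))))
          (≤-trans (≤-reflexive deg-v-M′) z≤n))
  ... | inj₂ (inj₁ k≡1+k′) with drop>0⇒unsaturated (≤-reflexive (≡-sym k≡1+k′))
  ...   | w , v~w , unsat with extend-M′ v~w unsat
  ...     | M₁ , matching₁ , longer , deg≤1 , _ = ⊥-elim (SatVertex⇒¬deg≤1 {G = T} saturated
            (isMax matching₁ (subst (_≤ length M₁) (≡-sym k≡1+k′) longer)) deg≤1)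

  drop≡0⇒branches-saturated : k ≡ k′ → ∀ w → Adj T v w → SatVertex T (Branch w) w
  drop≡0⇒branches-saturated k≡k′ w v~w = ¬deg≤1⇒SatVertex {G = T} λ K maxK deg≤1 →
    let M₁ , matching₁ , longer , _ = extend-M′ v~w (K , maxK , deg≤1)
    in <⇒≱ longer (subst (length M₁ ≤_) k≡k′ (length≤ν₂ matching₁))

  branches-saturated⇒drop≡0 : (∀ w → Adj T v w → SatVertex T (Branch w) w) → k ≡ k′
  branches-saturated⇒drop≡0 saturated =
    ≤-antisym (subst (_≤ k′) length-Mₛ (length≤ν₂∖v matchingMₛ λ v~w _ → saturated _ v~w)) k′≤k

  SaturatedSpoke : Set
  SaturatedSpoke = ∃ λ wj → Adj T v wj × SatEdge T Full v wj
                     × (∀ wi → Adj T v wi → wi ≢ wj → SatVertex T (Branch wi) wi)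

  saturated-spoke⇒drop≡1 : SaturatedSpoke → k ≡ suc k′
  saturated-spoke⇒drop≡1 (wj , v~wj , saturated-edge , saturated) with drop∈0,1,2
  ... | inj₂ (inj₁ k≡1+k′) = k≡1+k′
  ... | inj₁ k≡k′ = ⊥-elim (n≮0 (subst (0 <_) deg-v-M′ (∈ᴱ⇒0<deg (saturated-edge M′
          (isMax (is2Matching-Full {G = T} matchingM′) (≤-reflexive (trans k≡k′ (≡-sym length-M′))))))))
  ... | inj₂ (inj₂ k≡2+k′) = ⊥-elim (1+n≰n (begin
    suc (suc k′)           ≡⟨ ≡-sym k≡2+k′ ⟩
    k                      ≡⟨ ≡-sym length-Mₛ ⟩
    length Mₛ              ≤⟨ length≤1+length-filter-≢ _≟ᴱ_ (proj₁ (proj₂ matchingMₛ)) ⟩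
    suc (length M₋)        ≤⟨ s≤s (length≤ν₂∖v (filter-is2Matching {G = T} _ matchingMₛ) saturated′) ⟩
    suc k′                 ∎))
    where
    open ≤-Reasoning
    M₋ = filter (λ e → ¬? (e ≟ᴱ spoke wj)) Mₛ
    saturated′ : ∀ {w} → Adj T v w → spoke w ∈ M₋ → SatVertex T (Branch w) w
    saturated′ {w} v~w spoke∈ = saturated w v~w λ w≡wj →
      proj₂ (∈-filter⁻ (λ e → ¬? (e ≟ᴱ spoke wj)) {xs = Mₛ} spoke∈) (cong spoke w≡wj)

  drop≡1⇒saturated-spoke : k ≡ suc k′ → SaturatedSpoke
  drop≡1⇒saturated-spoke k≡1+k′ with drop>0⇒unsaturated (≤-reflexive (≡-sym k≡1+k′))
  ... | wj , v~wj , unsat = wj , v~wj , saturated-edge , saturated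
    where
    saturated : ∀ wi → Adj T v wi → wi ≢ wj → SatVertex T (Branch wi) wi
    saturated wi v~wi wi≢wj = ¬deg≤1⇒SatVertex {G = T} λ N maxN deg≤1 →
      let M₂ , matching₂ , longer = extend-M′-twice v~wi v~wj wi≢wj (N , maxN , deg≤1) unsat
      in <⇒≱ longer (subst (_ ≤_) k≡1+k′ (length≤ν₂ matching₂))
    saturated-edge : SatEdge T Full v wj
    saturated-edge M maxM@(matching , _) with any? (spoke wj ≟ᴱ_) M
    ... | yes spoke∈ = edge∈⇒∈ᴱ spoke∈
    ... | no  spoke∉ = ⊥-elim (<⇒≱ (subst (_≤ length M) k≡1+k′ (ν₂≤length {G = T} ν maxM))
            (length≤ν₂∖v matching λ {w} v~w spoke-w∈ →
              saturated w v~w λ w≡wj → spoke∉ (subst (λ x → spoke x ∈ M) w≡wj spoke-w∈)))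

lemma2p5 : ∀ {n} (T : Graph n) → IsTree T → (v : Fin n) →
    ∀ k k′ → IsNu2 T Full k → IsNu2 T (Full ∖ v) k′ →
      ((k ≡ k′ ⊎ k ≡ suc k′ ⊎ k ≡ 2 + k′)
      × ((k ≡ 2 + k′) ⇔ SatVertex T Full v)
      × ((k ≡ suc k′) ⇔ (Σ (Fin n) λ wj → Adj T v wj × SatEdge T Full v wj
            × (∀ wi → Adj T v wi → wi ≢ wj →
                 SatVertex T (Component T (Full ∖ v) wi) wi)))
      × ((k ≡ k′) ⇔ (∀ wi → Adj T v wi →
                 SatVertex T (Component T (Full ∖ v) wi) wi)))
lemma2p5 T tree v k k′ ν ν′ =
  drop∈0,1,2 ,
  mk⇔ drop≡2⇒saturated saturated⇒drop≡2 ,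
  mk⇔ drop≡1⇒saturated-spoke saturated-spoke⇒drop≡1 ,
  mk⇔ drop≡0⇒branches-saturated branches-saturated⇒drop≡0
  where open Drop T tree v ν ν′
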